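{- Let $q=4$, $p\in\{ -1,1\}$ and $w=6$. Put $E=1$, $A=7\tau-66p$, $F=-16p\tau+10$, $B=-65$, $G=10p\tau-9$. Then $A\tau^5+B=E\tau^{12}+F\tau^6+G$, and $A,B,E,F,G$ all belong to the minimal norm digit set modulo $\tau^6$, so both sides are valid digit expansions; in particular the $6$-NAF is not a minimal (optimal) digit expansion.
   Context: $\tau=\frac p2+i\sqrt{q-\frac14}$ is a root of $X^2-pX+q$ and $\mathbb{Z}[\tau]=\{x+y\tau:x,y\in\mathbb{Z}\}$. The minimal norm digit set modulo $\tau^w$ is the set consisting of $0$ together with, for each residue class of $\mathbb{Z}[\tau]$ modulo $\tau^w$ not divisible by $\tau$, its (unique) representative of minimal absolute value. The $w$-NAF is an expansion in which every block of $w$ consecutive digits contains at most one nonzero digit; it is minimal if the $w$-NAF of every element of $\mathbb{Z}[\tau]$ has minimal weight (number of nonzero digits) among all expansions of that element with digits in the digit set. -}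

module Defs where

open import Data.Nat as ℕ using (ℕ; zero; suc)
open import Data.Integer as ℤ using (ℤ; +_; -_; _*_; _+_; _-_; _<_)
import Data.Integer.Properties as ℤP
open import Data.List using (List; []; _∷_; length; filter)
open import Data.List.Relation.Unary.All using (All)
open import Data.Product using (Σ; ∃; _×_; _,_)
open import Data.Sum using (_⊎_)
open import Relation.Nullary using (¬_; Dec; yes; no; ¬?)
open import Relation.Binary.PropositionalEquality using (_≡_; _≢_; refl; cong₂)

-- Elements x + y τ of ℤ[τ], where τ is a root of X² - pX + q.
record Zτ : Set where
  constructor ⟨_,_⟩
  field
    re : ℤ
    im : ℤ

open Zτ public

_≟τ_ : (a b : Zτ) → Dec (a ≡ b)
⟨ x , y ⟩ ≟τ ⟨ x' , y' ⟩ with x ℤP.≟ x' | y ℤP.≟ y'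
... | yes refl | yes refl = yes refl
... | no ne | _ = no λ { refl → ne refl }
... | yes _ | no ne = no λ { refl → ne refl }

module Arith (p q : ℤ) where

  zero' : Zτ
  zero' = ⟨ + 0 , + 0 ⟩

  one : Zτ
  one = ⟨ + 1 , + 0 ⟩

  τ : Zτ
  τ = ⟨ + 0 , + 1 ⟩

  ι : ℤ → Zτ
  ι n = ⟨ n , + 0 ⟩

  _⊕_ : Zτ → Zτ → Zτ
  ⟨ a , b ⟩ ⊕ ⟨ c , d ⟩ = ⟨ a + c , b + d ⟩

  ⊖_ : Zτ → Zτ
  ⊖ ⟨ a , b ⟩ = ⟨ - a , - b ⟩

  _⊝_ : Zτ → Zτ → Zτ
  u ⊝ v = u ⊕ (⊖ v)

  -- (a + bτ)(c + dτ) using τ² = pτ - q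
  _⊗_ : Zτ → Zτ → Zτ
  ⟨ a , b ⟩ ⊗ ⟨ c , d ⟩ = ⟨ a * c - q * (b * d) , a * d + b * c + p * (b * d) ⟩

  _^τ_ : Zτ → ℕ → Zτ
  u ^τ zero = one
  u ^τ suc n = u ⊗ (u ^τ n)

  -- N(x + yτ) = |x + yτ|² = x² + pxy + qy²
  norm : Zτ → ℤ
  norm ⟨ x , y ⟩ = x * x + p * (x * y) + q * (y * y)

  _∣τ_ : Zτ → Zτ → Set
  m ∣τ u = ∃ λ c → u ≡ m ⊗ c

  IsDigit : ℕ → Zτ → Set
  IsDigit w d = d ≡ zero' ⊎
    ((¬ (τ ∣τ d)) × (∀ z → (τ ^τ w) ∣τ (z ⊝ d) → z ≢ d → norm d < norm z))

  -- Digit expansions: lists of digits, least significant first.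
  -- value [d₀, d₁, …] = Σ dᵢ τ^i
  value : List Zτ → Zτ
  value [] = zero'
  value (d ∷ ds) = d ⊕ (τ ⊗ value ds)

  IsExpansion : ℕ → List Zτ → Set
  IsExpansion w ds = All (IsDigit w) ds

  digitAt : List Zτ → ℕ → Zτ
  digitAt [] _ = zero'
  digitAt (d ∷ ds) zero = d
  digitAt (d ∷ ds) (suc i) = digitAt ds i

  IsWNAF : ℕ → List Zτ → Set
  IsWNAF w ds = ∀ i j → i ℕ.< j → j ℕ.< i ℕ.+ w →
    digitAt ds i ≡ zero' ⊎ digitAt ds j ≡ zero'

  weight : List Zτ → ℕ
  weight ds = length (filter (λ d → ¬? (d ≟τ zero')) ds)

  WNAFMinimal : ℕ → Set
  WNAFMinimal w = ∀ ds → IsExpansion w ds → IsWNAF w ds →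
    ∀ es → IsExpansion w es → value es ≡ value ds → weight ds ℕ.≤ weight es

-- Write N(x + yτ) = x² + pxy + 4y² and B for the associated bilinear form.  For
-- p = ±1 Lagrange's identity 4·N(u)·N(v) = B(u,v)² + 15·(xy' - x'y)² gives
-- |B(u,v)| ≤ 2·√(N(u)·N(v)), so N(u + v) = N(u) + N(v) + B(u,v) exceeds N(u) as
-- soon as N(v) > 4·N(u).  With T = τ⁶ and N(T) = 4096, a nonzero d with
-- 4·N(d) < 5·N(T) therefore only has to beat the elements d + Tc with N(c) ≤ 4,
-- and those c have |x| ≤ 2, |y| ≤ 1.  This turns "d is a digit" into a finite
-- check, done by evaluation for the five digits; then the 6-NAF G + Fτ⁶ + Eτ¹²
-- of weight 3 and the expansion B + Aτ⁵ of weight 2 have the same value.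

module Submission where

open import Defs
open import Data.Nat using (ℕ)
open import Data.Integer using (ℤ; +_; -_; _*_; _+_; _-_)
open import Data.Product using (_×_)
open import Data.Sum using (_⊎_)
open import Relation.Nullary using (¬_)
open import Relation.Binary.PropositionalEquality using (_≡_)

open import Data.Nat as ℕ using (zero; suc; z≤n; s≤s; _∸_)
import Data.Nat.Properties as ℕP
open import Data.Nat.Divisibility as ℕ∣ using (divides; _∣0; ∣m∣n⇒∣m+n; ∣-refl; m∣m*n)
open import Data.Integer as ℤ using (∣_∣; -[1+_]; _≤_; _<_; +≤+; +<+; 0ℤ) renaming (suc to sucℤ)
open import Data.Integer.Base using (nonNegative; positive)
import Data.Integer.Properties as ℤP
open import Data.Integer.Divisibility using () renaming (_∣_ to _∣ℤ_)
open import Data.Integer.Tactic.RingSolver using (solve)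
open import Data.List using (List; []; _∷_; _++_; replicate)
open import Data.List.Membership.Propositional using (_∈_)
open import Data.List.Relation.Unary.Any using (here; there)
open import Data.List.Relation.Unary.All using (All; all?; lookup)
open import Data.List.Relation.Unary.All.Properties using (++⁺; replicate⁺)
open import Data.Product using (_,_)
open import Data.Sum as Sum using (inj₁; inj₂)
open import Data.Empty using (⊥-elim)
open import Function using (id)
open import Relation.Nullary using (Dec; yes; no; ¬?)
open import Relation.Nullary.Decidable using (True; toWitness; _×-dec_; _⊎-dec_)
open import Relation.Binary.PropositionalEquality using (_≢_; refl; sym; trans; cong; cong₂; subst; subst₂)

i*i≡∣i∣*∣i∣ : ∀ i → i * i ≡ + (∣ i ∣ ℕ.* ∣ i ∣)
i*i≡∣i∣*∣i∣ (+ n)    = sym (ℤP.pos-* n n)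
i*i≡∣i∣*∣i∣ -[1+ n ] = refl

0≤i*i : ∀ i → 0ℤ ≤ i * i
0≤i*i i = subst (0ℤ ≤_) (sym (i*i≡∣i∣*∣i∣ i)) (+≤+ z≤n)

0≤k*[i*i] : ∀ {k} i → 0ℤ ≤ k → 0ℤ ≤ k * (i * i)
0≤k*[i*i] i 0≤k = ℤP.*-monoʳ-≤-nonNeg (i * i) {{nonNegative (0≤i*i i)}} 0≤k

m*m<n*n⇒m<n : ∀ {m n} → m ℕ.* m ℕ.< n ℕ.* n → m ℕ.< n
m*m<n*n⇒m<n m*m<n*n = ℕP.≰⇒> (λ n≤m → ℕP.<⇒≱ m*m<n*n (ℕP.*-mono-≤ n≤m n≤m))

j*j<i*i⇒0<i+j : ∀ {i j} → 0ℤ ≤ i → j * j < i * i → 0ℤ < i + j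
j*j<i*i⇒0<i+j {+ n} {j} _ j*j<i*i = positive-sum j ∣j∣<n
  where
  ∣j∣<n : ∣ j ∣ ℕ.< n
  ∣j∣<n = m*m<n*n⇒m<n (ℤP.drop‿+<+ (subst₂ _<_ (i*i≡∣i∣*∣i∣ j) (i*i≡∣i∣*∣i∣ (+ n)) j*j<i*i))
  positive-sum : ∀ j → ∣ j ∣ ℕ.< n → 0ℤ < + n + j
  positive-sum (+ k)    k<n = +<+ (ℕP.<-≤-trans (ℕP.≤-<-trans z≤n k<n) (ℕP.m≤m+n n k))
  positive-sum -[1+ k ] k<n = subst (0ℤ <_) (sym (ℤP.⊖-≥ {n} {suc k} (ℕP.<⇒≤ k<n))) (+<+ (ℕP.m<n⇒0<n∸m k<n))

k*[i*i]≤m⇒∣i∣≤b : ∀ {k m} b i → + k * (i * i) ≤ + m → m ℕ.< k ℕ.* (suc b ℕ.* suc b) → ∣ i ∣ ℕ.≤ b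
k*[i*i]≤m⇒∣i∣≤b {k} {m} b i k*i²≤m m<k*b² = ℕP.≮⇒≥ λ b<∣i∣ →
  ℕP.<⇒≱ m<k*b² (ℕP.≤-trans (ℕP.*-monoʳ-≤ k (ℕP.*-mono-≤ b<∣i∣ b<∣i∣)) k*∣i∣²≤m)
  where
  k*∣i∣²≤m : k ℕ.* (∣ i ∣ ℕ.* ∣ i ∣) ℕ.≤ m
  k*∣i∣²≤m = ℤP.drop‿+≤+ (subst (_≤ + m) (trans (cong (+ k *_) (i*i≡∣i∣*∣i∣ i)) (sym (ℤP.pos-* k _))) k*i²≤m)

i≤j*j+i : ∀ i j → i ≤ j * j + i
i≤j*j+i i j = ℤP.i≤j+i i (j * j) {{nonNegative (0≤i*i j)}}

i∣i*j : ∀ i j → i ∣ℤ i * j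
i∣i*j i j = subst (∣ i ∣ ℕ∣.∣_) (sym (ℤP.abs-* i j)) (m∣m*n ∣ j ∣)

window : ℕ → List ℤ
window zero    = + 0 ∷ []
window (suc n) = + suc n ∷ -[1+ n ] ∷ window n

∈-window : ∀ {n} i → ∣ i ∣ ℕ.≤ n → i ∈ window n
∈-window {zero}  (+ zero)  _ = here refl
∈-window {suc n} (+ zero)  _ = there (there (∈-window (+ zero) z≤n))
∈-window {suc n} (+ suc k) (s≤s k≤n) with ℕP.m≤n⇒m<n∨m≡n k≤n
... | inj₁ k<n  = there (there (∈-window (+ suc k) k<n))
... | inj₂ refl = here refl
∈-window {suc n} -[1+ k ]  (s≤s k≤n) with ℕP.m≤n⇒m<n∨m≡n k≤n
... | inj₁ k<n  = there (there (∈-window -[1+ k ] k<n))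
... | inj₂ refl = there (here refl)

module NormProperties (p q : ℤ) where
  open Arith p q

  disc : ℤ
  disc = + 4 * q - p * p

  polar : Zτ → Zτ → ℤ
  polar ⟨ x , y ⟩ ⟨ x' , y' ⟩ = + 2 * (x * x') + p * (x * y' + x' * y) + + 2 * q * (y * y')

  cross : Zτ → Zτ → ℤ
  cross ⟨ x , y ⟩ ⟨ x' , y' ⟩ = x * y' - x' * y

  -- `solve` does not unfold `norm`, so each identity is proved on the expanded polynomials.
  norm-⊕ : ∀ u v → norm (u ⊕ v) ≡ norm u + norm v + polar u v
  norm-⊕ ⟨ x , y ⟩ ⟨ x' , y' ⟩ = identity
    where
    identity : (x + x') * (x + x') + p * ((x + x') * (y + y')) + q * ((y + y') * (y + y'))
             ≡ (x * x + p * (x * y) + q * (y * y)) + (x' * x' + p * (x' * y') + q * (y' * y'))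
               + (+ 2 * (x * x') + p * (x * y' + x' * y) + + 2 * q * (y * y'))
    identity = solve (p ∷ q ∷ x ∷ y ∷ x' ∷ y' ∷ [])

  norm-⊗ : ∀ u v → norm (u ⊗ v) ≡ norm u * norm v
  norm-⊗ ⟨ a , b ⟩ ⟨ c , d ⟩ = identity
    where
    identity : (a * c - q * (b * d)) * (a * c - q * (b * d))
               + p * ((a * c - q * (b * d)) * (a * d + b * c + p * (b * d)))
               + q * ((a * d + b * c + p * (b * d)) * (a * d + b * c + p * (b * d)))
             ≡ (a * a + p * (a * b) + q * (b * b)) * (c * c + p * (c * d) + q * (d * d))
    identity = solve (p ∷ q ∷ a ∷ b ∷ c ∷ d ∷ [])

  4*norm*norm≡polar²+disc*cross² : ∀ u v →
    + 4 * norm u * norm v ≡ polar u v * polar u v + disc * (cross u v * cross u v)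
  4*norm*norm≡polar²+disc*cross² ⟨ x , y ⟩ ⟨ x' , y' ⟩ = identity
    where
    identity : + 4 * (x * x + p * (x * y) + q * (y * y)) * (x' * x' + p * (x' * y') + q * (y' * y'))
             ≡ (+ 2 * (x * x') + p * (x * y' + x' * y) + + 2 * q * (y * y'))
               * (+ 2 * (x * x') + p * (x * y' + x' * y) + + 2 * q * (y * y'))
               + (+ 4 * q - p * p) * ((x * y' - x' * y) * (x * y' - x' * y))
    identity = solve (p ∷ q ∷ x ∷ y ∷ x' ∷ y' ∷ [])

  4*norm≡square+disc*im² : ∀ x y →
    + 4 * norm ⟨ x , y ⟩ ≡ (+ 2 * x + p * y) * (+ 2 * x + p * y) + disc * (y * y)
  4*norm≡square+disc*im² x y = identity
    where
    identity : + 4 * (x * x + p * (x * y) + q * (y * y))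
             ≡ (+ 2 * x + p * y) * (+ 2 * x + p * y) + (+ 4 * q - p * p) * (y * y)
    identity = solve (p ∷ q ∷ x ∷ y ∷ [])

  4*q*norm≡square+disc*re² : ∀ x y →
    + 4 * q * norm ⟨ x , y ⟩ ≡ (p * x + + 2 * q * y) * (p * x + + 2 * q * y) + disc * (x * x)
  4*q*norm≡square+disc*re² x y = identity
    where
    identity : + 4 * q * (x * x + p * (x * y) + q * (y * y))
             ≡ (p * x + + 2 * q * y) * (p * x + + 2 * q * y) + (+ 4 * q - p * p) * (x * x)
    identity = solve (p ∷ q ∷ x ∷ y ∷ [])

  ⊕-identityʳ : ∀ u → u ⊕ zero' ≡ u
  ⊕-identityʳ ⟨ x , y ⟩ = cong₂ ⟨_,_⟩ (ℤP.+-identityʳ x) (ℤP.+-identityʳ y)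

  ⊗-zeroʳ : ∀ u → u ⊗ zero' ≡ zero'
  ⊗-zeroʳ ⟨ x , y ⟩ = cong₂ ⟨_,_⟩ re-identity im-identity
    where
    re-identity : x * + 0 - q * (y * + 0) ≡ + 0
    re-identity = solve (q ∷ x ∷ y ∷ [])
    im-identity : x * + 0 + y * + 0 + p * (y * + 0) ≡ + 0
    im-identity = solve (p ∷ x ∷ y ∷ [])

  ⊕-⊝-cancel : ∀ u v → u ≡ v ⊕ (u ⊝ v)
  ⊕-⊝-cancel ⟨ x , y ⟩ ⟨ x' , y' ⟩ = cong₂ ⟨_,_⟩ (identity x x') (identity y y')
    where
    identity : ∀ a b → a ≡ b + (a - b)
    identity a b = solve (a ∷ b ∷ [])

  re[τ⊗u]≡q*-im : ∀ u → re (τ ⊗ u) ≡ q * - im u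
  re[τ⊗u]≡q*-im ⟨ x , y ⟩ = identity
    where
    identity : + 0 * x - q * (+ 1 * y) ≡ q * - y
    identity = solve (q ∷ x ∷ y ∷ [])

  τ∣⇒q∣re : ∀ u → τ ∣τ u → q ∣ℤ re u
  τ∣⇒q∣re u (v , refl) = subst (q ∣ℤ_) (sym (re[τ⊗u]≡q*-im v)) (i∣i*j q (- im v))

  Improves : ℕ → Zτ → Zτ → Set
  Improves w d c = c ≡ zero' ⊎ norm d < norm (d ⊕ ((τ ^τ w) ⊗ c))

  improves? : ∀ w d c → Dec (Improves w d c)
  improves? w d c = (c ≟τ zero') ⊎-dec (norm d ℤP.<? norm (d ⊕ ((τ ^τ w) ⊗ c)))

  module _ (0≤disc : 0ℤ ≤ disc) where

    0≤norm : ∀ u → 0ℤ ≤ norm u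
    0≤norm ⟨ x , y ⟩ = ℤP.*-cancelˡ-≤-pos 0ℤ (norm ⟨ x , y ⟩) (+ 4)
      (subst (0ℤ ≤_) (sym (4*norm≡square+disc*im² x y)) (ℤP.+-mono-≤ (0≤i*i (+ 2 * x + p * y)) (0≤k*[i*i] y 0≤disc)))

    4*norm<norm⇒norm<norm-⊕ : ∀ u v → + 4 * norm u < norm v → norm u < norm (u ⊕ v)
    4*norm<norm⇒norm<norm-⊕ u v 4N[u]<N[v] = begin-strict
      norm u                        ≡⟨ sym (ℤP.+-identityʳ (norm u)) ⟩
      norm u + 0ℤ                   <⟨ ℤP.+-monoʳ-< (norm u) 0<N[v]+β ⟩
      norm u + (norm v + polar u v) ≡⟨ sym (ℤP.+-assoc (norm u) (norm v) (polar u v)) ⟩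
      norm u + norm v + polar u v   ≡⟨ sym (norm-⊕ u v) ⟩
      norm (u ⊕ v)                  ∎
      where
      open ℤP.≤-Reasoning
      0<N[v] : 0ℤ < norm v
      0<N[v] = ℤP.≤-<-trans (ℤP.*-monoˡ-≤-nonNeg (+ 4) (0≤norm u)) 4N[u]<N[v]
      β²<N[v]² : polar u v * polar u v < norm v * norm v
      β²<N[v]² = begin-strict
        polar u v * polar u v
          ≤⟨ ℤP.i≤i+j _ _ {{nonNegative (0≤k*[i*i] (cross u v) 0≤disc)}} ⟩
        polar u v * polar u v + disc * (cross u v * cross u v)
          ≡⟨ sym (4*norm*norm≡polar²+disc*cross² u v) ⟩
        + 4 * norm u * norm v
          <⟨ ℤP.*-monoʳ-<-pos (norm v) {{positive 0<N[v]}} 4N[u]<N[v] ⟩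
        norm v * norm v ∎
      0<N[v]+β : 0ℤ < norm v + polar u v
      0<N[v]+β = j*j<i*i⇒0<i+j (ℤP.<⇒≤ 0<N[v]) β²<N[v]²

    isDigit-if-improves-on-small : ∀ w d R → ¬ (τ ∣τ d) → + 4 * norm d < norm (τ ^τ w) * sucℤ R →
      (∀ c → norm c ≤ R → Improves w d c) → IsDigit w d
    isDigit-if-improves-on-small w d R τ∤d bound improves-below = inj₂ (τ∤d , minimal)
      where
      T : Zτ
      T = τ ^τ w
      improves : ∀ c → Improves w d c
      improves c with norm c ℤP.≤? R
      ... | yes N[c]≤R = improves-below c N[c]≤R
      ... | no  N[c]≰R = inj₂ (4*norm<norm⇒norm<norm-⊕ d (T ⊗ c) (begin-strict
        + 4 * norm d    <⟨ bound ⟩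
        norm T * sucℤ R ≤⟨ ℤP.*-monoˡ-≤-nonNeg (norm T) {{nonNegative (0≤norm T)}}
                             (ℤP.i<j⇒suc[i]≤j (ℤP.≰⇒> N[c]≰R)) ⟩
        norm T * norm c ≡⟨ sym (norm-⊗ T c) ⟩
        norm (T ⊗ c)    ∎))
        where open ℤP.≤-Reasoning
      minimal : ∀ z → T ∣τ (z ⊝ d) → z ≢ d → norm d < norm z
      minimal z (c , z⊝d≡Tc) z≢d =
        subst (norm d <_) (cong norm (sym z≡d⊕Tc)) (Sum.[ c≡0-case , id ]′ (improves c))
        where
        z≡d⊕Tc : z ≡ d ⊕ (T ⊗ c)
        z≡d⊕Tc = trans (⊕-⊝-cancel z d) (cong (d ⊕_) z⊝d≡Tc)
        c≡0-case : c ≡ zero' → norm d < norm (d ⊕ (T ⊗ c))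
        c≡0-case refl = ⊥-elim (z≢d (trans z≡d⊕Tc (trans (cong (d ⊕_) (⊗-zeroʳ T)) (⊕-identityʳ d))))

module SpacedExpansions (p q : ℤ) where
  open Arith p q
  open import Data.List.Relation.Unary.All using ([]; _∷_)

  spaced : ℕ → List Zτ → List Zτ
  spaced w []       = []
  spaced w (d ∷ ds) = d ∷ replicate (w ∸ 1) zero' ++ spaced w ds

  SupportedOn : (ℕ → Set) → List Zτ → Set
  SupportedOn P ds = ∀ i → digitAt ds i ≡ zero' ⊎ P i

  supportedOn-mono : ∀ {P Q : ℕ → Set} {ds} → (∀ {i} → P i → Q i) → SupportedOn P ds → SupportedOn Q ds
  supportedOn-mono P⇒Q supp i = Sum.map₂ P⇒Q (supp i)

  supportedOn-padding : ∀ {P} m ds → SupportedOn (λ i → P (m ℕ.+ i)) ds → SupportedOn P (replicate m zero' ++ ds)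
  supportedOn-padding zero    ds supp i       = supp i
  supportedOn-padding (suc m) ds supp zero    = inj₁ refl
  supportedOn-padding {P} (suc m) ds supp (suc i) = supportedOn-padding {λ i → P (suc i)} m ds supp i

  supportedOn-spaced : ∀ k a ds → suc k ℕ∣.∣ a → SupportedOn (λ i → suc k ℕ∣.∣ a ℕ.+ i) (spaced (suc k) ds)
  supportedOn-spaced k a []       _   i       = inj₁ refl
  supportedOn-spaced k a (d ∷ ds) k∣a zero    = inj₂ (subst (suc k ℕ∣.∣_) (sym (ℕP.+-identityʳ a)) k∣a)
  supportedOn-spaced k a (d ∷ ds) k∣a (suc i) =
    supportedOn-padding {λ i → suc k ℕ∣.∣ a ℕ.+ suc i} k (spaced (suc k) ds)
    (supportedOn-mono {ds = spaced (suc k) ds} (subst (suc k ℕ∣.∣_) (ℕP.+-assoc a (suc k) _))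
      (supportedOn-spaced k (a ℕ.+ suc k) ds (∣m∣n⇒∣m+n k∣a ∣-refl))) i

  isWNAF-if-supportedOn-multiples : ∀ w ds → SupportedOn (w ℕ∣.∣_) ds → IsWNAF w ds
  isWNAF-if-supportedOn-multiples w ds supp i j i<j j<i+w with supp i | supp j
  ... | inj₁ dᵢ≡0 | _         = inj₁ dᵢ≡0
  ... | inj₂ _    | inj₁ dⱼ≡0 = inj₂ dⱼ≡0
  ... | inj₂ (divides a refl) | inj₂ (divides b refl) = ⊥-elim (ℕP.<⇒≱ a<b (ℕP.≤-pred b<1+a))
    where
    a<b : a ℕ.< b
    a<b = ℕP.*-cancelʳ-< w a b i<j
    b<1+a : b ℕ.< suc a
    b<1+a = ℕP.*-cancelʳ-< w b (suc a) (subst (b ℕ.* w ℕ.<_) (ℕP.+-comm (a ℕ.* w) w) j<i+w)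

  isWNAF-spaced : ∀ k ds → IsWNAF (suc k) (spaced (suc k) ds)
  isWNAF-spaced k ds = isWNAF-if-supportedOn-multiples (suc k) (spaced (suc k) ds) (supportedOn-spaced k 0 ds (suc k ∣0))

  All-spaced : ∀ {P : Zτ → Set} w {ds} → P zero' → All P ds → All P (spaced w ds)
  All-spaced w P0 []         = []
  All-spaced w P0 (Pd ∷ Pds) = Pd ∷ ++⁺ (replicate⁺ (w ∸ 1) P0) (All-spaced w P0 Pds)

module UnitTrace (p : ℤ) (p*p≡1 : p * p ≡ + 1) where
  open Arith p (+ 4)
  open NormProperties p (+ 4)

  disc≡15 : disc ≡ + 15
  disc≡15 = cong (λ s → + 16 - s) p*p≡1

  0≤disc : 0ℤ ≤ disc
  0≤disc = subst (0ℤ ≤_) (sym disc≡15) (+≤+ z≤n)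

  norm≤4⇒∈windows : ∀ x y → norm ⟨ x , y ⟩ ≤ + 4 → x ∈ window 2 × y ∈ window 1
  norm≤4⇒∈windows x y N≤4 =
    ∈-window x (k*[i*i]≤m⇒∣i∣≤b {15} {64} 2 x 15x²≤64 (ℕP.m≤m+n 65 70)) ,
    ∈-window y (k*[i*i]≤m⇒∣i∣≤b {15} {16} 1 y 15y²≤16 (ℕP.m≤m+n 17 43))
    where
    open ℤP.≤-Reasoning
    15x²≤64 : + 15 * (x * x) ≤ + 64
    15x²≤64 = begin
      + 15 * (x * x)         ≡⟨ cong (_* (x * x)) (sym disc≡15) ⟩
      disc * (x * x)         ≤⟨ i≤j*j+i _ (p * x + + 8 * y) ⟩
      _                      ≡⟨ sym (4*q*norm≡square+disc*re² x y) ⟩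
      + 16 * norm ⟨ x , y ⟩  ≤⟨ ℤP.*-monoˡ-≤-nonNeg (+ 16) N≤4 ⟩
      + 64                   ∎
    15y²≤16 : + 15 * (y * y) ≤ + 16
    15y²≤16 = begin
      + 15 * (y * y)         ≡⟨ cong (_* (y * y)) (sym disc≡15) ⟩
      disc * (y * y)         ≤⟨ i≤j*j+i _ (+ 2 * x + p * y) ⟩
      _                      ≡⟨ sym (4*norm≡square+disc*im² x y) ⟩
      + 4 * norm ⟨ x , y ⟩   ≤⟨ ℤP.*-monoˡ-≤-nonNeg (+ 4) N≤4 ⟩
      + 16                   ∎

  -- The factor 5 is 1 + 4, where 4 bounds the norms of the multipliers c that are searched.
  DigitCertificate : ℕ → Zτ → Set
  DigitCertificate w d = ¬ (+ 4 ∣ℤ re d) × + 4 * norm d < norm (τ ^τ w) * + 5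
    × All (λ x → All (λ y → Improves w d ⟨ x , y ⟩) (window 1)) (window 2)

  digitCertificate? : ∀ w d → Dec (DigitCertificate w d)
  digitCertificate? w d = ¬? (4 ℕ∣.∣? ∣ re d ∣) ×-dec (_ ℤP.<? _)
    ×-dec all? (λ x → all? (λ y → improves? w d ⟨ x , y ⟩) (window 1)) (window 2)

  isDigit-if-certified : ∀ w d → DigitCertificate w d → IsDigit w d
  isDigit-if-certified w d (4∤re , bound , search) =
    isDigit-if-improves-on-small 0≤disc w d (+ 4) (λ τ∣d → 4∤re (τ∣⇒q∣re d τ∣d)) bound improves-below
    where
    improves-below : ∀ c → norm c ≤ + 4 → Improves w d c
    improves-below ⟨ x , y ⟩ N≤4 with norm≤4⇒∈windows x y N≤4
    ... | x∈ , y∈ = lookup (lookup search x∈) y∈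

module Counterexample (p : ℤ) (p*p≡1 : p * p ≡ + 1) where
  open Arith p (+ 4)
  open SpacedExpansions p (+ 4)
  open UnitTrace p p*p≡1
  open import Data.List.Relation.Unary.All using ([]; _∷_)

  E A F B G : Zτ
  E = ι (+ 1)
  A = (ι (+ 7) ⊗ τ) ⊝ ι (+ 66 * p)
  F = (ι (- (+ 16) * p) ⊗ τ) ⊕ ι (+ 10)
  B = ι (- (+ 65))
  G = (ι (+ 10 * p) ⊗ τ) ⊝ ι (+ 9)

  naf shorter : List Zτ
  naf     = spaced 6 (G ∷ F ∷ E ∷ [])
  shorter = B ∷ zero' ∷ zero' ∷ zero' ∷ zero' ∷ A ∷ []

  Computation : Set
  Computation = All (DigitCertificate 6) (A ∷ B ∷ E ∷ F ∷ G ∷ [])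
    × value shorter ≡ value naf × weight shorter ℕ.< weight naf

  computation? : Dec Computation
  computation? = all? (digitCertificate? 6) _ ×-dec (_ ≟τ _) ×-dec (_ ℕ.<? _)

  Digits×NotMinimal : Set
  Digits×NotMinimal = (IsDigit 6 A × IsDigit 6 B × IsDigit 6 E × IsDigit 6 F × IsDigit 6 G) × ¬ WNAFMinimal 6

  digits×notMinimal-if-computed : Computation → Digits×NotMinimal
  digits×notMinimal-if-computed ((cA ∷ cB ∷ cE ∷ cF ∷ cG ∷ []) , same-value , lighter) =
    (digit A cA , digit B cB , digit E cE , digit F cF , digit G cG) , not-minimal
    where
    digit : ∀ d → DigitCertificate 6 d → IsDigit 6 d
    digit = isDigit-if-certified 6
    0-digit : IsDigit 6 zero'
    0-digit = inj₁ refl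
    not-minimal : ¬ WNAFMinimal 6
    not-minimal minimal = ℕP.<⇒≱ lighter (minimal naf
      (All-spaced 6 0-digit (digit G cG ∷ digit F cF ∷ digit E cE ∷ [])) (isWNAF-spaced 5 (G ∷ F ∷ E ∷ []))
      shorter (digit B cB ∷ 0-digit ∷ 0-digit ∷ 0-digit ∷ 0-digit ∷ digit A cA ∷ []) same-value)

  digits×notMinimal : {_ : True computation?} → Digits×NotMinimal
  digits×notMinimal {computed} = digits×notMinimal-if-computed (toWitness computed)

proposition17p1 : (p : ℤ) → (p ≡ + 1 ⊎ p ≡ - (+ 1)) →
    let open Arith p (+ 4)
        E = ι (+ 1)
        A = (ι (+ 7) ⊗ τ) ⊝ ι (+ 66 * p)
        F = (ι (- (+ 16) * p) ⊗ τ) ⊕ ι (+ 10)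
        B = ι (- (+ 65))
        G = (ι (+ 10 * p) ⊗ τ) ⊝ ι (+ 9)
    in ((A ⊗ (τ ^τ 5)) ⊕ B ≡ ((E ⊗ (τ ^τ 12)) ⊕ (F ⊗ (τ ^τ 6))) ⊕ G)
       × (IsDigit 6 A × IsDigit 6 B × IsDigit 6 E × IsDigit 6 F × IsDigit 6 G)
       × ¬ WNAFMinimal 6
proposition17p1 .(+ 1)     (inj₁ refl) = refl , Counterexample.digits×notMinimal (+ 1) refl
proposition17p1 .(- (+ 1)) (inj₂ refl) = refl , Counterexample.digits×notMinimal (- (+ 1)) refl
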